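{- For all integers $0\le t<j$, \[ L(j,t)=L(j,t+1)-\left(\Lambda_{j-t}-1\right)\frac{a_{t+1}-a_t}{\Lambda-1}. \]
   Context: Fix nonnegative integers $\lambda_1,\lambda_2,\dots$ and an integer $k\ge1$ (the order) such that $\lambda_1\ge1$, $\lambda_k\ge1$, $\lambda_i=0$ for $i>k$, and $\lambda_1\ge2$ if $k=1$. Define $(a_n)_{n\in\mathbb Z}$ by $a_n=1$ for $n\le0$ and $a_n=\sum_{i=1}^k\lambda_ia_{n-i}$ for $n\ge1$. Let $\Lambda_j=\sum_{i=1}^j\lambda_i$ and $\Lambda=\Lambda_k$. Finite ordered trees $T_j$: $T_0$ is a single node; for $j\ge1$, $T_j$ has a chain of special nodes $s_j$ (root), $s_{j-1},\dots,s_0$ with $s_i$ on level $i$ and $s_{i-1}$ the leftmost child of $s_i$, and $s_i$ ($1\le i\le j$) has $\Lambda_{j-i+1}$ children: $s_{i-1}$ followed by $\Lambda_{j-i+1}-1$ roots of copies of $T_{i-1}$. For $0\le t\le j$, $L(j,t)$ denotes the number of leaves of $T_j$ that descend from (or equal) its special node $s_t$ on level $t$. -}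

module Defs where

open import Data.Nat using (ℕ; zero; suc; _+_; _*_; _∸_)
open import Data.List using (List; []; _∷_; replicate)
open import Data.Integer as ℤ using (ℤ; +_)
open import Function using (_∘_)

-- The coefficients λ_1, λ_2, … are given as a function  lam : ℕ → ℕ  with
-- λ_i = lam i for i ≥ 1 (the value  lam 0  is never used).

sum1 : ℕ → (ℕ → ℕ) → ℕ
sum1 zero    f = 0
sum1 (suc m) f = sum1 m f + f (suc m)

Lam : (ℕ → ℕ) → ℕ → ℕ
Lam lam j = sum1 j lam

-- History of the sequence:  hist lam k n i = a_{n-i}  (an integer index that
-- may be negative, in which case the value is 1).
hist : (ℕ → ℕ) → ℕ → ℕ → ℕ → ℕ
hist lam k zero    i       = 1
hist lam k (suc n) zero    = sum1 k (λ i → lam i * hist lam k n (i ∸ 1))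
hist lam k (suc n) (suc i) = hist lam k n i

seqA : (ℕ → ℕ) → ℕ → ℕ → ℕ
seqA lam k n = hist lam k n 0

data Tree : Set where
  node : List Tree → Tree

mutual
  leaves : Tree → ℕ
  leaves (node []) = 1
  leaves (node (c ∷ cs)) = leavesL (c ∷ cs)

  leavesL : List Tree → ℕ
  leavesL []       = 0
  leavesL (c ∷ cs) = leaves c + leavesL cs

-- leftmost child (a leaf is sent to itself; never used on leaves below)
leftmost : Tree → Tree
leftmost (node [])      = node []
leftmost (node (c ∷ _)) = c

iter : ℕ → (Tree → Tree) → Tree → Tree
iter zero    f x = x
iter (suc n) f x = f (iter n f x)

-- chain lam i d : the subtree rooted at the special node s_i of T_{i+d}.
-- s_0 is a leaf; s_{i+1} (in T_{i+1+d}) has Λ_{d+1} children: s_i followed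
-- by Λ_{d+1} - 1 copies of T_i.
chain : (ℕ → ℕ) → ℕ → ℕ → Tree
chain lam zero    d = node []
chain lam (suc i) d =
  node (chain lam i (suc d) ∷ replicate (Lam lam (suc d) ∸ 1) (chain lam i 0))

T : (ℕ → ℕ) → ℕ → Tree
T lam j = chain lam j 0

L : (ℕ → ℕ) → ℕ → ℕ → ℕ
L lam j t = leaves (iter (j ∸ t) leftmost (T lam j))

-- Every leaf below the special node s_{t+1} of T_j lies either below s_t or in one of the
-- Λ_{j-t} - 1 copies of T_t hanging from s_{t+1}, so the theorem reduces to
-- (Λ - 1) |T_t| = a_{t+1} - a_t.  That identity is the case d = 0 of the invariant
--   (Λ - 1) · leaves(s_i in T_{i+d}) + a_i = Λ_d a_i + Σ_{m=1}^{k} λ_{d+m} a_{i+1-m},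
-- proved by induction on i for all d at once: both sides obey the same recursion, since
-- peeling the first term off the right-hand sum turns the case (i+1, d) into (i, d+1).
module Submission where

open import Defs
open import Data.Nat using (ℕ; suc; _≤_; _<_; _∸_)
open import Data.Integer using (ℤ; +_; _+_; _-_; _*_)
open import Relation.Binary.PropositionalEquality using (_≡_)

open import Data.Nat as ℕ using (zero; z≤n; s≤s)
import Data.Nat.Properties as ℕ
import Data.Integer.Properties as ℤ
import Data.Nat.Tactic.RingSolver as ℕ-Solver
import Data.Integer.Tactic.RingSolver as ℤ-Solver
open import Data.List using ([]; _∷_; replicate)
open import Function using (_∘_)
open import Relation.Binary.PropositionalEquality
  using (refl; sym; trans; cong; cong₂; module ≡-Reasoning)

open ≡-Reasoning

sum1-cong : ∀ n {f g : ℕ → ℕ} → (∀ m → f (suc m) ≡ g (suc m)) → sum1 n f ≡ sum1 n g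
sum1-cong zero    f≗g = refl
sum1-cong (suc n) f≗g = cong₂ ℕ._+_ (sum1-cong n f≗g) (f≗g n)

sum1-suc-shift : ∀ n (f : ℕ → ℕ) → sum1 (suc n) f ≡ f 1 ℕ.+ sum1 n (f ∘ suc)
sum1-suc-shift zero    f = ℕ.+-comm 0 (f 1)
sum1-suc-shift (suc n) f =
  trans (cong (ℕ._+ f (suc (suc n))) (sum1-suc-shift n f)) (ℕ.+-assoc (f 1) _ _)

sum1-+ : ∀ m n (f : ℕ → ℕ) → sum1 (m ℕ.+ n) f ≡ sum1 m f ℕ.+ sum1 n (λ i → f (m ℕ.+ i))
sum1-+ m zero    f = trans (cong (λ x → sum1 x f) (ℕ.+-identityʳ m)) (sym (ℕ.+-identityʳ _))
sum1-+ m (suc n) f = begin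
  sum1 (m ℕ.+ suc n) f                          ≡⟨ cong (λ x → sum1 x f) (ℕ.+-suc m n) ⟩
  sum1 (m ℕ.+ n) f ℕ.+ f (suc (m ℕ.+ n))        ≡⟨ cong (ℕ._+ f (suc (m ℕ.+ n))) (sum1-+ m n f) ⟩
  sum1 m f ℕ.+ sum1 n g ℕ.+ f (suc (m ℕ.+ n))   ≡⟨ ℕ.+-assoc (sum1 m f) _ _ ⟩
  sum1 m f ℕ.+ (sum1 n g ℕ.+ f (suc (m ℕ.+ n))) ≡⟨ cong (λ x → sum1 m f ℕ.+ (sum1 n g ℕ.+ f x)) (sym (ℕ.+-suc m n)) ⟩
  sum1 m f ℕ.+ sum1 (suc n) g                   ∎
  where
  g : ℕ → ℕ
  g i = f (m ℕ.+ i)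

Lam-positive : ∀ (lam : ℕ → ℕ) {n} → 1 ≤ n → 1 ≤ lam 1 → 1 ≤ Lam lam n
Lam-positive lam {suc zero}    _ λ₁≥1 = λ₁≥1
Lam-positive lam {suc (suc n)} _ λ₁≥1 = ℕ.≤-trans (Lam-positive lam {suc n} (s≤s z≤n) λ₁≥1) (ℕ.m≤m+n _ _)

Lam-stable : ∀ (lam : ℕ → ℕ) k → (∀ i → k < i → lam i ≡ 0) → ∀ d → Lam lam (d ℕ.+ k) ≡ Lam lam k
Lam-stable lam k vanish zero    = refl
Lam-stable lam k vanish (suc d) =
  trans (cong (Lam lam (d ℕ.+ k) ℕ.+_) (vanish _ (s≤s (ℕ.m≤n+m k d))))
        (trans (ℕ.+-identityʳ _) (Lam-stable lam k vanish d))

leavesL-replicate : ∀ n x → leavesL (replicate n x) ≡ n ℕ.* leaves x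
leavesL-replicate zero    x = refl
leavesL-replicate (suc n) x = cong (leaves x ℕ.+_) (leavesL-replicate n x)

leaves-chain-suc : ∀ lam i d →
  leaves (chain lam (suc i) d)
    ≡ leaves (chain lam i (suc d)) ℕ.+ (Lam lam (suc d) ∸ 1) ℕ.* leaves (T lam i)
leaves-chain-suc lam i d =
  cong (leaves (chain lam i (suc d)) ℕ.+_) (leavesL-replicate (Lam lam (suc d) ∸ 1) (chain lam i 0))

iter-leftmost-chain : ∀ lam m i d → iter m leftmost (chain lam (m ℕ.+ i) d) ≡ chain lam i (m ℕ.+ d)
iter-leftmost-chain lam zero    i d = refl
iter-leftmost-chain lam (suc m) i d =
  trans (cong (λ n → leftmost (iter m leftmost (chain lam n d))) (sym (ℕ.+-suc m i)))
        (cong leftmost (iter-leftmost-chain lam m (suc i) d))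

L≡leaves-chain : ∀ lam {j t} → t ≤ j → L lam j t ≡ leaves (chain lam t (j ∸ t))
L≡leaves-chain lam {j} {t} t≤j = begin
  leaves (iter (j ∸ t) leftmost (T lam j))
    ≡⟨ cong (λ n → leaves (iter (j ∸ t) leftmost (chain lam n 0))) (sym (ℕ.m∸n+n≡m t≤j)) ⟩
  leaves (iter (j ∸ t) leftmost (chain lam (j ∸ t ℕ.+ t) 0))
    ≡⟨ cong leaves (iter-leftmost-chain lam (j ∸ t) t 0) ⟩
  leaves (chain lam t (j ∸ t ℕ.+ 0))
    ≡⟨ cong (leaves ∘ chain lam t) (ℕ.+-identityʳ (j ∸ t)) ⟩
  leaves (chain lam t (j ∸ t)) ∎

L-suc : ∀ lam {j t} → t < j → L lam j (suc t) ≡ L lam j t ℕ.+ (Lam lam (j ∸ t) ∸ 1) ℕ.* leaves (T lam t)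
L-suc lam {j} {t} t<j = begin
  L lam j (suc t)
    ≡⟨ L≡leaves-chain lam t<j ⟩
  leaves (chain lam (suc t) (j ∸ suc t))
    ≡⟨ leaves-chain-suc lam t (j ∸ suc t) ⟩
  leaves (chain lam t (suc (j ∸ suc t))) ℕ.+ (Lam lam (suc (j ∸ suc t)) ∸ 1) ℕ.* leaves (T lam t)
    ≡⟨ cong (λ e → leaves (chain lam t e) ℕ.+ (Lam lam e ∸ 1) ℕ.* leaves (T lam t)) (sym j∸t≡) ⟩
  leaves (chain lam t (j ∸ t)) ℕ.+ (Lam lam (j ∸ t) ∸ 1) ℕ.* leaves (T lam t)
    ≡⟨ cong (ℕ._+ (Lam lam (j ∸ t) ∸ 1) ℕ.* leaves (T lam t)) (sym (L≡leaves-chain lam (ℕ.<⇒≤ t<j))) ⟩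
  L lam j t ℕ.+ (Lam lam (j ∸ t) ∸ 1) ℕ.* leaves (T lam t) ∎
  where
  j∸t≡ : j ∸ t ≡ suc (j ∸ suc t)
  j∸t≡ = ℕ.+-∸-assoc 1 t<j

invariant-step : ∀ M c n a₀ a₁ B R → 1 ≤ B →
  M ℕ.* c ℕ.+ a₀ ≡ B ℕ.* a₀ ℕ.+ R → M ℕ.* n ℕ.+ a₀ ≡ a₁ →
  M ℕ.* (c ℕ.+ (B ∸ 1) ℕ.* n) ℕ.+ a₁ ≡ B ℕ.* a₁ ℕ.+ R
invariant-step M c n a₀ a₁ (suc b) R _ eq₀ eq₁ = ℕ.+-cancelʳ-≡ (suc b ℕ.* a₀) _ _ (begin
  M ℕ.* (c ℕ.+ b ℕ.* n) ℕ.+ a₁ ℕ.+ suc b ℕ.* a₀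
    ≡⟨ solve (M ∷ c ∷ n ∷ a₀ ∷ a₁ ∷ b ∷ []) ⟩
  (M ℕ.* c ℕ.+ a₀) ℕ.+ b ℕ.* (M ℕ.* n ℕ.+ a₀) ℕ.+ a₁
    ≡⟨ cong₂ (λ x y → x ℕ.+ b ℕ.* y ℕ.+ a₁) eq₀ eq₁ ⟩
  suc b ℕ.* a₀ ℕ.+ R ℕ.+ b ℕ.* a₁ ℕ.+ a₁
    ≡⟨ solve (a₀ ∷ a₁ ∷ b ∷ R ∷ []) ⟩
  suc b ℕ.* a₁ ℕ.+ R ℕ.+ suc b ℕ.* a₀ ∎)
  where open ℕ-Solver

-- tail lam k i d = Σ_{m=1}^{k} λ_{d+m} a_{i+1-m}; tail lam k i 0 is definitionally a_{i+1}.
tail : (ℕ → ℕ) → ℕ → ℕ → ℕ → ℕ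
tail lam k i d = sum1 k (λ m → lam (d ℕ.+ m) ℕ.* hist lam k i (m ∸ 1))

tail-suc : ∀ lam k → (∀ i → k < i → lam i ≡ 0) → ∀ i d →
  tail lam k (suc i) d ≡ lam (suc d) ℕ.* seqA lam k (suc i) ℕ.+ tail lam k i (suc d)
tail-suc lam zero     vanish i d = sym (trans (ℕ.+-identityʳ _) (ℕ.*-zeroʳ (lam (suc d))))
tail-suc lam (suc k′) vanish i d = begin
  sum1 (suc k′) (λ m → lam (d ℕ.+ m) ℕ.* h (suc i) (m ∸ 1))
    ≡⟨ sum1-suc-shift k′ _ ⟩
  lam (d ℕ.+ 1) ℕ.* a (suc i) ℕ.+ sum1 k′ (λ m → lam (d ℕ.+ suc m) ℕ.* h (suc i) m)
    ≡⟨ cong₂ (λ e s → lam e ℕ.* a (suc i) ℕ.+ s) (ℕ.+-comm d 1)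
             (sum1-cong k′ (λ m → cong (λ e → lam e ℕ.* h i m) (ℕ.+-suc d (suc m)))) ⟩
  lam (suc d) ℕ.* a (suc i) ℕ.+ sum1 k′ s
    ≡⟨ cong (lam (suc d) ℕ.* a (suc i) ℕ.+_) (sym (ℕ.+-identityʳ _)) ⟩
  lam (suc d) ℕ.* a (suc i) ℕ.+ (sum1 k′ s ℕ.+ 0 ℕ.* h i k′)
    ≡⟨ cong (λ x → lam (suc d) ℕ.* a (suc i) ℕ.+ (sum1 k′ s ℕ.+ x ℕ.* h i k′))
            (sym (vanish _ (s≤s (ℕ.m≤n+m (suc k′) d)))) ⟩
  lam (suc d) ℕ.* a (suc i) ℕ.+ sum1 (suc k′) s ∎
  where
  h : ℕ → ℕ → ℕ
  h = hist lam (suc k′)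

  a : ℕ → ℕ
  a = seqA lam (suc k′)

  s : ℕ → ℕ
  s m = lam (suc d ℕ.+ m) ℕ.* h i (m ∸ 1)

module Recurrence (lam : ℕ → ℕ) (k : ℕ) (vanish : ∀ i → k < i → lam i ≡ 0) where

  Λ : ℕ
  Λ = Lam lam k

  a : ℕ → ℕ
  a = seqA lam k

  Lam-+-tail-zero : ∀ d → Lam lam d ℕ.* 1 ℕ.+ tail lam k 0 d ≡ Λ
  Lam-+-tail-zero d = begin
    Lam lam d ℕ.* 1 ℕ.+ tail lam k 0 d
      ≡⟨ cong₂ ℕ._+_ (ℕ.*-identityʳ _) (sum1-cong k (λ m → ℕ.*-identityʳ _)) ⟩
    Lam lam d ℕ.+ sum1 k (λ m → lam (d ℕ.+ m))
      ≡⟨ sym (sum1-+ d k lam) ⟩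
    Lam lam (d ℕ.+ k)
      ≡⟨ Lam-stable lam k vanish d ⟩
    Λ ∎

  module _ (k≥1 : 1 ≤ k) (λ₁≥1 : 1 ≤ lam 1) where

    Λ∸1+1≡Λ : (Λ ∸ 1) ℕ.* 1 ℕ.+ 1 ≡ Λ
    Λ∸1+1≡Λ = trans (cong (ℕ._+ 1) (ℕ.*-identityʳ _)) (ℕ.m∸n+n≡m (Lam-positive lam k≥1 λ₁≥1))

    leaves-chain-invariant : ∀ i d →
      (Λ ∸ 1) ℕ.* leaves (chain lam i d) ℕ.+ a i ≡ Lam lam d ℕ.* a i ℕ.+ tail lam k i d
    leaves-chain-invariant zero    d = trans Λ∸1+1≡Λ (sym (Lam-+-tail-zero d))
    leaves-chain-invariant (suc i) d = begin
      (Λ ∸ 1) ℕ.* leaves (chain lam (suc i) d) ℕ.+ a (suc i)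
        ≡⟨ cong (λ x → (Λ ∸ 1) ℕ.* x ℕ.+ a (suc i)) (leaves-chain-suc lam i d) ⟩
      (Λ ∸ 1) ℕ.* (leaves (chain lam i (suc d)) ℕ.+ (Lam lam (suc d) ∸ 1) ℕ.* leaves (T lam i)) ℕ.+ a (suc i)
        ≡⟨ invariant-step (Λ ∸ 1) _ _ (a i) _ _ _ (Lam-positive lam {suc d} (s≤s z≤n) λ₁≥1)
             (leaves-chain-invariant i (suc d)) (leaves-chain-invariant i 0) ⟩
      (Lam lam d ℕ.+ lam (suc d)) ℕ.* a (suc i) ℕ.+ tail lam k i (suc d)
        ≡⟨ cong (ℕ._+ tail lam k i (suc d)) (ℕ.*-distribʳ-+ (a (suc i)) (Lam lam d) (lam (suc d))) ⟩
      Lam lam d ℕ.* a (suc i) ℕ.+ lam (suc d) ℕ.* a (suc i) ℕ.+ tail lam k i (suc d)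
        ≡⟨ ℕ.+-assoc (Lam lam d ℕ.* a (suc i)) _ _ ⟩
      Lam lam d ℕ.* a (suc i) ℕ.+ (lam (suc d) ℕ.* a (suc i) ℕ.+ tail lam k i (suc d))
        ≡⟨ cong (Lam lam d ℕ.* a (suc i) ℕ.+_) (sym (tail-suc lam k vanish i d)) ⟩
      Lam lam d ℕ.* a (suc i) ℕ.+ tail lam k (suc i) d ∎

    leaves-T : ∀ i → (Λ ∸ 1) ℕ.* leaves (T lam i) ℕ.+ a i ≡ a (suc i)
    leaves-T i = leaves-chain-invariant i 0

clear-denominator : ∀ {l l′ a a′} M D τ → l′ ≡ l ℕ.+ D ℕ.* τ → M ℕ.* τ ℕ.+ a ≡ a′ →
  + M * + l ≡ + M * + l′ - + D * (+ a′ - + a)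
clear-denominator {l} {a = a} M D τ refl refl = begin
  + M * + l
    ≡⟨ identity (+ M) (+ l) (+ D) (+ τ) (+ a) ⟩
  + M * (+ l + + D * + τ) - + D * ((+ M * + τ + + a) - + a)
    ≡⟨ cong₂ (λ x y → + M * x - + D * (y - + a))
         (trans (cong (λ x → + l + x) (sym (ℤ.pos-* D τ))) (sym (ℤ.pos-+ l (D ℕ.* τ))))
         (trans (cong (_+ + a) (sym (ℤ.pos-* M τ))) (sym (ℤ.pos-+ (M ℕ.* τ) a))) ⟩
  + M * + (l ℕ.+ D ℕ.* τ) - + D * (+ (M ℕ.* τ ℕ.+ a) - + a) ∎
  where
  identity : ∀ m l d τ a → m * l ≡ m * (l + d * τ) - d * ((m * τ + a) - a)
  identity = ℤ-Solver.solve-∀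

lemma4p11 : (lam : ℕ → ℕ) (k : ℕ) →
    1 ≤ k → 1 ≤ lam 1 → 1 ≤ lam k → (∀ i → k < i → lam i ≡ 0) →
    (k ≡ 1 → 2 ≤ lam 1) →
    (j t : ℕ) → t < j →
    (+ (Lam lam k ∸ 1)) * (+ L lam j t)
      ≡ (+ (Lam lam k ∸ 1)) * (+ L lam j (suc t))
        - (+ (Lam lam (j ∸ t) ∸ 1)) * (+ seqA lam k (suc t) - + seqA lam k t)
lemma4p11 lam k k≥1 λ₁≥1 _ vanish _ j t t<j =
  clear-denominator (Lam lam k ∸ 1) (Lam lam (j ∸ t) ∸ 1) (leaves (T lam t))
    (L-suc lam t<j) (Recurrence.leaves-T lam k vanish k≥1 λ₁≥1 t)
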